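{- $\boldsymbol m=1\varphi(\boldsymbol\ell)$, where $\boldsymbol\ell$ and $\boldsymbol m$ are the lexicographically least and greatest faux-bonacci $\omega$-words.
   Context: $\varphi$ is the morphism $0\mapsto01$, $1\mapsto0$. For non-empty $X$, $X^-$ is $X$ with last letter erased; a $4^-$-power is $XXXX^-$ with $X$ non-empty; a binary word is faux-bonacci (fb) if it has no factor $11$ and no factor that is a $4^-$-power. Lexicographic order uses $0<1$. $\boldsymbol\ell=\lim_n\ell_n$ and $\boldsymbol m=\lim_n m_n$, where $\ell_n$ (resp. $m_n$) is the lexicographically least (resp. greatest) length-$n$ word that is a prefix of some fb $\omega$-word; $\boldsymbol\ell$ (resp. $\boldsymbol m$) is the lexicographically least (resp. greatest) fb $\omega$-word. -}

module Defs where

open import Data.Bool using (Bool; true; false)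
open import Data.Nat using (ℕ; zero; suc; _<_)
open import Data.List using (List; []; _∷_; _++_; concatMap)
open import Data.Product using (Σ; ∃; _×_; _,_)
open import Relation.Binary.PropositionalEquality using (_≡_)
open import Relation.Nullary using (¬_)
open import Data.Sum using (_⊎_)

-- Binary letters: false = 0, true = 1.  Finite words: List Bool.
-- ω-words: functions ℕ → Bool.
Word : Set
Word = List Bool

ωWord : Set
ωWord = ℕ → Bool

φ₁ : Bool → Word
φ₁ false = false ∷ true ∷ []
φ₁ true  = false ∷ []

φ : Word → Word
φ = concatMap φ₁

-- X⁻ : X with its last letter erased (only used for non-empty X).
dropLast : Word → Word
dropLast []           = []
dropLast (x ∷ [])     = []
dropLast (x ∷ y ∷ ys) = x ∷ dropLast (y ∷ ys)

Factor : Word → Word → Set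
Factor u w = Σ Word λ p → Σ Word λ s → w ≡ p ++ u ++ s

Is4⁻Power : Word → Set
Is4⁻Power u = Σ Bool λ x → Σ Word λ xs →
  u ≡ (x ∷ xs) ++ (x ∷ xs) ++ (x ∷ xs) ++ dropLast (x ∷ xs)

FB : Word → Set
FB w = ¬ Factor (true ∷ true ∷ []) w × (∀ u → Factor u w → ¬ Is4⁻Power u)

pref : ωWord → ℕ → Word
pref w zero    = []
pref w (suc n) = w 0 ∷ pref (λ i → w (suc i)) n

-- An ω-word is fb iff it has no factor 11 and no 4⁻-power factor,
-- i.e. iff all its finite prefixes are fb (every factor lies in a prefix).
FBω : ωWord → Set
FBω w = ∀ n → FB (pref w n)

-- nth letter of a finite word (default 0; never used out of range below)
nth : Word → ℕ → Bool
nth []       _       = false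
nth (x ∷ xs) zero    = x
nth (x ∷ xs) (suc i) = nth xs i

-- φ applied to an ω-word: letter i of φ(w) is letter i of φ(w[0..i]),
-- which is well defined since |φ(u)| ≥ |u|.
φω : ωWord → ωWord
φω w i = nth (φ (pref w (suc i))) i

_∷ω_ : Bool → ωWord → ωWord
(a ∷ω w) zero    = a
(a ∷ω w) (suc i) = w i

_<lex_ : ωWord → ωWord → Set
x <lex y = Σ ℕ λ k → (∀ i → i < k → x i ≡ y i) × (x k ≡ false) × (y k ≡ true)

_≈ω_ : ωWord → ωWord → Set
x ≈ω y = ∀ i → x i ≡ y i

_≤lex_ : ωWord → ωWord → Set
x ≤lex y = x ≈ω y ⊎ x <lex y

IsLeastFB : ωWord → Set
IsLeastFB ℓ = FBω ℓ × (∀ w → FBω w → ℓ ≤lex w)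

IsGreatestFB : ωWord → Set
IsGreatestFB m = FBω m × (∀ w → FBω w → w ≤lex m)

{-# OPTIONS --safe #-}
-- The least fb ω-word ℓ begins with 00: every fb word of length 7 contains 00 (otherwise it
-- contains 11 or is the 4⁻-power (01)³0 or (10)³1), and the suffix of ℓ starting at such an
-- occurrence is fb, hence not smaller than ℓ.  If 00u is fb then so is 1φ(00u): a 4⁻-power in an
-- image under φ can be moved to start with 0 and then desubstituted into a defect of the preimage.
-- So x = 1φ(ℓ) ≤ m; hence m begins with 1, and having no 11 it is 1φ(w) for some w.  As φ(w)0 is
-- fb only if w is, ℓ ≤ w, and since φ reverses the lexicographic order, m = 1φ(w) ≤ 1φ(ℓ) = x.
module Submission where

open import Defs
open import Data.Bool using (Bool; true; false; not)
open import Data.Nat using (ℕ; zero; suc; _+_; _<_; _≤_; z≤n; s≤s)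
open import Data.Nat.Properties using (<-cmp; ≤-refl; ≤-trans; n≤1+n; m≤n+m)
open import Data.List using ([]; _∷_; _++_; _∷ʳ_; [_]; length; map; concat; initLast; _∷ʳ′_)
open import Data.List.Properties
  using (++-assoc; ++-cancelˡ; ∷-injective; ∷-injectiveˡ; ∷-injectiveʳ; ++-identityʳ; ++-monoid; map-++; concat-++; ∷ʳ-++)
open import Data.Product using (Σ; _×_; _,_; proj₁; proj₂)
open import Data.Sum using (_⊎_; inj₁; inj₂)
import Data.Sum as Sum
open import Data.Empty using (⊥; ⊥-elim)
open import Data.Unit using (⊤; tt)
open import Function using (_∘_)
open import Relation.Binary.PropositionalEquality hiding ([_])
open import Relation.Binary using (tri<; tri≈; tri>)
open import Relation.Nullary using (¬_)
open import Tactic.MonoidSolver using (solve)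

Contains11 : Word → Set
Contains11 = Factor (true ∷ true ∷ [])

Defect : Word → Set
Defect w = Contains11 w ⊎ Σ Word λ v → Factor v w × Is4⁻Power v

FB⇒¬Defect : ∀ {w} → FB w → ¬ Defect w
FB⇒¬Defect (no11 , _)   (inj₁ c)            = no11 c
FB⇒¬Defect (_ , no4⁻) (inj₂ (v , fv , pv)) = no4⁻ v fv pv

¬Defect⇒FB : ∀ {w} → ¬ Defect w → FB w
¬Defect⇒FB ¬d = (λ c → ¬d (inj₁ c)) , λ v fv pv → ¬d (inj₂ (v , fv , pv))

Factor-trans : ∀ {u v w} → Factor u v → Factor v w → Factor u w
Factor-trans {u} (p , s , refl) (p′ , s′ , refl) = p′ ++ p , s ++ s′ , solve (++-monoid Bool)

Defect-factor : ∀ {v w} → Factor v w → Defect v → Defect w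
Defect-factor f (inj₁ c)            = inj₁ (Factor-trans c f)
Defect-factor f (inj₂ (u , fu , pu)) = inj₂ (u , Factor-trans fu f , pu)

FB-factor : ∀ {v w} → Factor v w → FB w → FB v
FB-factor f fb = ¬Defect⇒FB (FB⇒¬Defect fb ∘ Defect-factor f)

Factor-∷ : ∀ x {u w} → Factor u w → Factor u (x ∷ w)
Factor-∷ x (p , s , e) = x ∷ p , s , cong (x ∷_) e

Contains11-0∷⁻ : ∀ {w} → Contains11 (false ∷ w) → Contains11 w
Contains11-0∷⁻ ([] , s , ())
Contains11-0∷⁻ (_ ∷ p , s , e) = p , s , ∷-injectiveʳ e

Contains11-++ : ∀ {v} r → Contains11 v → Contains11 (v ++ r)
Contains11-++ r (p , s , refl) = p , s ++ r , ++-assoc p (true ∷ true ∷ s) r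

000-Defect : ∀ p s → Defect (p ++ false ∷ false ∷ false ∷ s)
000-Defect p s = inj₂ (false ∷ false ∷ false ∷ [] , (p , s , refl) , (false , [] , refl))

No11 : Word → Set
No11 (true ∷ true ∷ _) = ⊥
No11 (_ ∷ w)           = No11 w
No11 []                = ⊤

No11-∷⁻ : ∀ x w → No11 (x ∷ w) → No11 w
No11-∷⁻ false w           h = h
No11-∷⁻ true  []          h = tt
No11-∷⁻ true  (false ∷ w) h = h

No11⇒¬Contains11 : ∀ w → No11 w → ¬ Contains11 w
No11⇒¬Contains11 _ h ([] , s , refl)    = h
No11⇒¬Contains11 _ h (x ∷ p , s , refl) =
  No11⇒¬Contains11 _ (No11-∷⁻ x _ h) (p , s , refl)

φ-++ : ∀ u v → φ (u ++ v) ≡ φ u ++ φ v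
φ-++ u v = trans (cong concat (map-++ φ₁ u v)) (sym (concat-++ (map φ₁ u) (map φ₁ v)))

mutual
  No11-φ : ∀ u → No11 (φ u)
  No11-φ []          = tt
  No11-φ (false ∷ u) = No11-1φ u
  No11-φ (true ∷ u)  = No11-φ u

  No11-1φ : ∀ u → No11 (true ∷ φ u)
  No11-1φ []          = tt
  No11-1φ (false ∷ u) = No11-1φ u
  No11-1φ (true ∷ u)  = No11-φ u

φ≢1∷ : ∀ u {r} → φ u ≢ true ∷ r
φ≢1∷ []          ()
φ≢1∷ (false ∷ u) ()
φ≢1∷ (true ∷ u)  ()

φ⁻¹-01 : ∀ u {R} → φ u ≡ false ∷ true ∷ R → Σ Word λ u′ → u ≡ false ∷ u′ × φ u′ ≡ R
φ⁻¹-01 (false ∷ u) refl = u , refl , refl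
φ⁻¹-01 (true ∷ u)  e    = ⊥-elim (φ≢1∷ u (∷-injectiveʳ e))

φ⁻¹-00 : ∀ u {R} → φ u ≡ false ∷ false ∷ R → Σ Word λ u′ → u ≡ true ∷ u′ × φ u′ ≡ false ∷ R
φ⁻¹-00 (true ∷ u) e = u , refl , ∷-injectiveʳ e

φ-injective : ∀ u v → φ u ≡ φ v → u ≡ v
φ-injective []          []          e = refl
φ-injective []          (false ∷ v) ()
φ-injective []          (true ∷ v)  ()
φ-injective (false ∷ u) []          ()
φ-injective (true ∷ u)  []          ()
φ-injective (false ∷ u) (false ∷ v) e = cong (false ∷_) (φ-injective u v (∷-injectiveʳ (∷-injectiveʳ e)))
φ-injective (true ∷ u)  (true ∷ v)  e = cong (true ∷_) (φ-injective u v (∷-injectiveʳ e))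
φ-injective (false ∷ u) (true ∷ v)  e = ⊥-elim (φ≢1∷ v (sym (∷-injectiveʳ e)))
φ-injective (true ∷ u)  (false ∷ v) e = ⊥-elim (φ≢1∷ u (∷-injectiveʳ e))

-- Every 0 of φ u is the first letter of the image of a letter of u.
φ-split : ∀ u P R → φ u ≡ P ++ false ∷ R →
          Σ Word λ u₁ → Σ Word λ u₂ → u ≡ u₁ ++ u₂ × φ u₁ ≡ P × φ u₂ ≡ false ∷ R
φ-split u [] R e = [] , u , refl , refl , e
φ-split (true ∷ u) (_ ∷ P) R e with refl , e′ ← ∷-injective e
  with u₁ , u₂ , refl , refl , e₂ ← φ-split u P R e′ = true ∷ u₁ , u₂ , refl , refl , e₂
φ-split (false ∷ u) (_ ∷ []) R e with () ← ∷-injectiveˡ (∷-injectiveʳ e)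
φ-split (false ∷ u) (_ ∷ _ ∷ P) R e with refl , e′ ← ∷-injective e
  with refl , e″ ← ∷-injective e′
  with u₁ , u₂ , refl , refl , e₂ ← φ-split u P R e″ = false ∷ u₁ , u₂ , refl , refl , e₂

pow4⁻ : Word → Word
pow4⁻ X = X ++ X ++ X ++ dropLast X

pow4⁻-++ : ∀ X S → pow4⁻ X ++ S ≡ X ++ X ++ X ++ dropLast X ++ S
pow4⁻-++ X S = solve (++-monoid Bool)

dropLast-++ : ∀ xs y ys → dropLast (xs ++ y ∷ ys) ≡ xs ++ dropLast (y ∷ ys)
dropLast-++ []           y ys = refl
dropLast-++ (x ∷ [])     y ys = refl
dropLast-++ (x ∷ x′ ∷ xs) y ys = cong (x ∷_) (dropLast-++ (x′ ∷ xs) y ys)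

dropLast-∷ʳ : ∀ xs (a : Bool) → dropLast (xs ∷ʳ a) ≡ xs
dropLast-∷ʳ xs a = trans (dropLast-++ xs a []) (++-identityʳ xs)

pow4⁻-rotate : ∀ (o : Bool) W S → Σ Bool λ c → o ∷ pow4⁻ (W ∷ʳ o) ++ S ≡ pow4⁻ (o ∷ W) ++ c ∷ S
pow4⁻-rotate o W S with initLast W
... | []       = o , refl
... | D ∷ʳ′ c rewrite dropLast-∷ʳ (D ∷ʳ c) o | dropLast-∷ʳ (o ∷ D) c = c , rotate [ o ] D [ c ] S
  where
  rotate : ∀ (o D c S : Word) →
           o ++ (((D ++ c) ++ o) ++ ((D ++ c) ++ o) ++ ((D ++ c) ++ o) ++ D ++ c) ++ S
           ≡ ((o ++ D ++ c) ++ (o ++ D ++ c) ++ (o ++ D ++ c) ++ o ++ D) ++ c ++ S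
  rotate o D c S = solve (++-monoid Bool)

No11-pow4⁻ : ∀ {G} A zs S → No11 G → G ≡ A ++ pow4⁻ (true ∷ zs) ++ S → Σ Word λ Y → zs ≡ Y ∷ʳ false
No11-pow4⁻ A zs S h e with initLast zs
... | []          = ⊥-elim (No11⇒¬Contains11 _ h (A , true ∷ S , e))
... | Y ∷ʳ′ false = Y , refl
... | Y ∷ʳ′ true  = ⊥-elim (No11⇒¬Contains11 _ h (A ++ true ∷ Y , _ , trans e (split11 A [ true ] Y _ S)))
  where
  split11 : ∀ (A o Y D S : Word) →
            A ++ ((o ++ Y ++ o) ++ (o ++ Y ++ o) ++ (o ++ Y ++ o) ++ D) ++ S
            ≡ (A ++ o ++ Y) ++ (o ++ o) ++ (Y ++ o ++ (o ++ Y ++ o) ++ D ++ S)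
  split11 A o Y D S = solve (++-monoid Bool)

φ-strip : ∀ u X {P R} → φ X ≡ P → φ u ≡ P ++ false ∷ R → Σ Word λ u′ → u ≡ X ++ u′ × φ u′ ≡ false ∷ R
φ-strip u X {P} {R} φX e with u₁ , u′ , refl , φu₁ , e′ ← φ-split u P R e
  rewrite φ-injective u₁ X (trans φu₁ (sym φX)) = u′ , refl , e′

prepend-dropLast : ∀ x {y ys w} →
                   Contains11 (y ∷ ys) ⊎ Σ Word (λ r → w ≡ dropLast (y ∷ ys) ++ r) →
                   Contains11 (x ∷ y ∷ ys) ⊎ Σ Word (λ r → x ∷ w ≡ dropLast (x ∷ y ∷ ys) ++ r)
prepend-dropLast x (inj₁ c)          = inj₁ (Factor-∷ x c)
prepend-dropLast x (inj₂ (r , refl)) = inj₂ (r , refl)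

φ⁻¹-dropLast : ∀ X w S → φ w ≡ dropLast (φ X) ++ S →
               Contains11 X ⊎ Σ Word λ rest → w ≡ dropLast X ++ rest
φ⁻¹-dropLast []                 w S e = inj₂ (w , refl)
φ⁻¹-dropLast (x ∷ [])           w S e = inj₂ (w , refl)
φ⁻¹-dropLast (true ∷ true ∷ ys) w S e = inj₁ ([] , ys , refl)
φ⁻¹-dropLast (false ∷ false ∷ ys) w S e with w′ , refl , e′ ← φ⁻¹-01 w e =
  prepend-dropLast false (φ⁻¹-dropLast (false ∷ ys) w′ S e′)
φ⁻¹-dropLast (false ∷ true ∷ ys) w S e with w′ , refl , e′ ← φ⁻¹-01 w e =
  prepend-dropLast false (φ⁻¹-dropLast (true ∷ ys) w′ S e′)
φ⁻¹-dropLast (true ∷ false ∷ ys) w S e with w′ , refl , e′ ← φ⁻¹-00 w e =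
  prepend-dropLast true (φ⁻¹-dropLast (false ∷ ys) w′ S e′)

φ⁻¹-0pow4⁻ : ∀ zs u S → φ u ≡ pow4⁻ (false ∷ zs) ++ S →
             Contains11 u ⊎ Σ Word λ V → Σ Word λ rest → u ≡ pow4⁻ V ++ rest × φ V ≡ false ∷ zs
φ⁻¹-0pow4⁻ [] u S e
  with u′ , refl , e′ ← φ⁻¹-00 u e
  with u″ , refl , _  ← φ⁻¹-00 u′ e′ = inj₁ ([] , u″ , refl)
φ⁻¹-0pow4⁻ zs@(_ ∷ _) u S e
  with X , u₂ , refl , φX , e₂ ← φ-split u (false ∷ zs) _ (trans e (pow4⁻-++ (false ∷ zs) S))
  with u₃ , refl , e₃ ← φ-strip u₂ X φX e₂
  with u₄ , refl , e₄ ← φ-strip u₃ X φX e₃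
  with φ⁻¹-dropLast X u₄ S (trans e₄ (cong (λ Z → dropLast Z ++ S) (sym φX)))
... | inj₁ c           = inj₁ (Contains11-++ _ c)
... | inj₂ (r , refl) = inj₂ (X , r , sym (pow4⁻-++ X r) , φX)

φ-0pow4⁻⇒Defect : ∀ P zs u S → φ u ≡ P ++ pow4⁻ (false ∷ zs) ++ S → Defect u
φ-0pow4⁻⇒Defect P zs u S e
  with u₁ , u₂ , refl , _ , e₂ ← φ-split u P _ e
  with φ⁻¹-0pow4⁻ zs u₂ S e₂
... | inj₁ (p , s , refl)               = inj₁ (u₁ ++ p , s , sym (++-assoc u₁ p _))
... | inj₂ (x ∷ xs , rest , refl , _) =
  inj₂ (pow4⁻ (x ∷ xs) , (u₁ , rest , refl) , (x , xs , refl))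

-- A 4⁻-power starting with 1 is preceded by 0 (φ u has no 11 and starts with 0); shifted one
-- letter to the left it becomes a 4⁻-power starting with 0.
φ-pow4⁻⇒Defect : ∀ u P z zs S → φ u ≡ P ++ pow4⁻ (z ∷ zs) ++ S → Defect u
φ-pow4⁻⇒Defect u P false zs S e = φ-0pow4⁻⇒Defect P zs u S e
φ-pow4⁻⇒Defect u P true zs S e with initLast P
... | []          = ⊥-elim (φ≢1∷ u e)
... | P′ ∷ʳ′ true =
  ⊥-elim (No11⇒¬Contains11 (φ u) (No11-φ u) (P′ , _ , trans e (∷ʳ-++ P′ true _)))
... | P′ ∷ʳ′ false
  with Y , refl ← No11-pow4⁻ (P′ ∷ʳ false) zs S (No11-φ u) e
  with c , rotated ← pow4⁻-rotate false (true ∷ Y) S =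
  φ-0pow4⁻⇒Defect P′ (true ∷ Y) u (c ∷ S) (trans e (trans (∷ʳ-++ P′ false _) (cong (P′ ++_) rotated)))

φ∷ʳ0-head : ∀ s → Σ Word λ r → φ s ∷ʳ false ≡ false ∷ r
φ∷ʳ0-head []          = [] , refl
φ∷ʳ0-head (false ∷ s) = true ∷ φ s ∷ʳ false , refl
φ∷ʳ0-head (true ∷ s)  = φ s ∷ʳ false , refl

φ-dropLast : ∀ X T → Σ Word λ r → φ (dropLast X) ++ false ∷ T ≡ dropLast (φ X) ++ r
φ-dropLast X T with initLast X
... | [] = false ∷ T , refl
... | D ∷ʳ′ false rewrite dropLast-∷ʳ D false | φ-++ D [ false ] | dropLast-++ (φ D) false (true ∷ []) =
  T , sym (++-assoc (φ D) [ false ] T)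
... | D ∷ʳ′ true rewrite dropLast-∷ʳ D true | φ-++ D [ true ] | dropLast-∷ʳ (φ D) false =
  false ∷ T , refl

φ-pow4⁻ : ∀ p X s → φ (p ++ pow4⁻ X ++ s) ≡ φ p ++ φ X ++ φ X ++ φ X ++ φ (dropLast X) ++ φ s
φ-pow4⁻ p X s
  rewrite φ-++ p (pow4⁻ X ++ s) | φ-++ (pow4⁻ X) s | φ-++ X (X ++ X ++ dropLast X)
        | φ-++ X (X ++ dropLast X) | φ-++ X (dropLast X) = solve (++-monoid Bool)

-- The appended 0 completes the image of the last block: 11 ↦ 00 is followed by 0, and
-- φ(X⁻) followed by 0 begins with (φ X)⁻.
Defect-φ∷ʳ0 : ∀ u → Defect u → Defect (φ u ∷ʳ false)
Defect-φ∷ʳ0 _ (inj₁ (p , s , refl)) with r , φs0 ← φ∷ʳ0-head s = subst Defect (sym image) (000-Defect (φ p) r)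
  where
  image : φ (p ++ true ∷ true ∷ s) ∷ʳ false ≡ φ p ++ false ∷ false ∷ false ∷ r
  image = begin
    φ (p ++ true ∷ true ∷ s) ∷ʳ false      ≡⟨ cong (_∷ʳ false) (φ-++ p _) ⟩
    (φ p ++ false ∷ false ∷ φ s) ∷ʳ false   ≡⟨ ++-assoc (φ p) _ [ false ] ⟩
    φ p ++ false ∷ false ∷ φ s ∷ʳ false     ≡⟨ cong (λ t → φ p ++ false ∷ false ∷ t) φs0 ⟩
    φ p ++ false ∷ false ∷ false ∷ r        ∎
    where open ≡-Reasoning
Defect-φ∷ʳ0 _ (inj₂ (_ , (p , s , refl) , (x , xs , refl)))
  with r₀ , φs0 ← φ∷ʳ0-head s
  with r , φX⁻ ← φ-dropLast (x ∷ xs) r₀ =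
  inj₂ (pow4⁻ (φ X) , (φ p , r , image) , power x)
  where
  X = x ∷ xs
  power : ∀ y → Is4⁻Power (pow4⁻ (φ (y ∷ xs)))
  power false = false , true ∷ φ xs , refl
  power true  = false , φ xs , refl
  image : φ (p ++ pow4⁻ X ++ s) ∷ʳ false ≡ φ p ++ pow4⁻ (φ X) ++ r
  image = begin
    φ (p ++ pow4⁻ X ++ s) ∷ʳ false
      ≡⟨ cong (_∷ʳ false) (φ-pow4⁻ p X s) ⟩
    (φ p ++ φ X ++ φ X ++ φ X ++ φ (dropLast X) ++ φ s) ∷ʳ false
      ≡⟨ solve (++-monoid Bool) ⟩
    φ p ++ φ X ++ φ X ++ φ X ++ φ (dropLast X) ++ φ s ∷ʳ false
      ≡⟨ cong (λ t → φ p ++ φ X ++ φ X ++ φ X ++ φ (dropLast X) ++ t) φs0 ⟩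
    φ p ++ φ X ++ φ X ++ φ X ++ φ (dropLast X) ++ false ∷ r₀
      ≡⟨ cong (λ t → φ p ++ φ X ++ φ X ++ φ X ++ t) φX⁻ ⟩
    φ p ++ φ X ++ φ X ++ φ X ++ dropLast (φ X) ++ r
      ≡⟨ cong (φ p ++_) (sym (pow4⁻-++ (φ X) r)) ⟩
    φ p ++ pow4⁻ (φ X) ++ r ∎
    where open ≡-Reasoning

FB-φ∷ʳ0⁻¹ : ∀ u → FB (φ u ∷ʳ false) → FB u
FB-φ∷ʳ0⁻¹ u fb = ¬Defect⇒FB (FB⇒¬Defect fb ∘ Defect-φ∷ʳ0 u)

000-pow4⁻-Defect : ∀ u₀ V rest {y ys} → false ∷ false ∷ false ∷ u₀ ≡ pow4⁻ V ++ rest →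
                   φ V ≡ false ∷ true ∷ y ∷ ys → Defect (false ∷ false ∷ u₀)
000-pow4⁻-Defect u₀ (false ∷ false ∷ [])       rest refl _ = 000-Defect [] _
000-pow4⁻-Defect u₀ (false ∷ false ∷ false ∷ ts) rest refl _ =
  subst Defect (cong (λ t → false ∷ false ∷ t) (sym (++-assoc ts _ rest))) (000-Defect (false ∷ false ∷ ts) _)

-- A 4⁻-power at the start of 1φ(00u₀) rotates into one at the start of φ(000u₀); its preimage is
-- a 4⁻-power at the start of 000u₀, which puts 000 into 00u₀.
1φ00-pow4⁻⇒Defect : ∀ u₀ P z zs S → true ∷ φ (false ∷ false ∷ u₀) ≡ P ++ pow4⁻ (z ∷ zs) ++ S →
                    Defect (false ∷ false ∷ u₀)
1φ00-pow4⁻⇒Defect u₀ (_ ∷ P) z zs S e = φ-pow4⁻⇒Defect _ P z zs S (∷-injectiveʳ e)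
1φ00-pow4⁻⇒Defect u₀ [] true zs S e with No11-pow4⁻ [] zs S (No11-1φ (false ∷ false ∷ u₀)) e
... | [] , refl
  with u′ , refl , _ ← φ⁻¹-01 u₀ (++-cancelˡ (true ∷ false ∷ true ∷ false ∷ true ∷ []) _ _ e) = 000-Defect [] u′
... | Y@(_ ∷ _) , refl
  with c , rotated ← pow4⁻-rotate false (true ∷ Y) S
  with φ⁻¹-0pow4⁻ (true ∷ Y) (false ∷ false ∷ false ∷ u₀) (c ∷ S) (trans (cong (false ∷_) e) rotated)
... | inj₁ c11                   = inj₁ (Contains11-0∷⁻ c11)
... | inj₂ (V , rest , eV , φV) = 000-pow4⁻-Defect u₀ V rest eV φV

FB-1φ00 : ∀ u₀ → FB (false ∷ false ∷ u₀) → FB (true ∷ φ (false ∷ false ∷ u₀))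
FB-1φ00 u₀ fb = No11⇒¬Contains11 _ (No11-1φ (false ∷ false ∷ u₀)) ,
  λ { _ (P , S , e) (z , zs , refl) → FB⇒¬Defect fb (1φ00-pow4⁻⇒Defect u₀ P z zs S e) }

tailω : ωWord → ωWord
tailω w i = w (suc i)

dropω : ℕ → ωWord → ωWord
dropω zero    w = w
dropω (suc n) w = dropω n (tailω w)

infixr 5 _++ω_
_++ω_ : Word → ωWord → ωWord
[]      ++ω x = x
(a ∷ u) ++ω x = a ∷ω (u ++ω x)

≈ω-sym : ∀ {x y} → x ≈ω y → y ≈ω x
≈ω-sym e i = sym (e i)

dropω-head : ∀ n w → dropω n w 0 ≡ w n
dropω-head zero    w = refl
dropω-head (suc n) w = dropω-head n (tailω w)

++ω-cong : ∀ u {x y} → x ≈ω y → (u ++ω x) ≈ω (u ++ω y)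
++ω-cong []      e i       = e i
++ω-cong (a ∷ u) e zero    = refl
++ω-cong (a ∷ u) e (suc i) = ++ω-cong u e i

++ω-assoc : ∀ u v x → ((u ++ v) ++ω x) ≈ω (u ++ω v ++ω x)
++ω-assoc []      v x i       = refl
++ω-assoc (a ∷ u) v x zero    = refl
++ω-assoc (a ∷ u) v x (suc i) = ++ω-assoc u v x i

pref-cong : ∀ n {x y} → x ≈ω y → pref x n ≡ pref y n
pref-cong zero    e = refl
pref-cong (suc n) e = cong₂ _∷_ (e 0) (pref-cong n (e ∘ suc))

pref-agree : ∀ k x y → (∀ i → i < k → x i ≡ y i) → pref x k ≡ pref y k
pref-agree zero    x y h = refl
pref-agree (suc k) x y h = cong₂ _∷_ (h 0 (s≤s z≤n)) (pref-agree k (tailω x) (tailω y) (λ i → h (suc i) ∘ s≤s))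

pref-+ : ∀ n k w → pref w (n + k) ≡ pref w n ++ pref (dropω n w) k
pref-+ zero    k w = refl
pref-+ (suc n) k w = cong (w 0 ∷_) (pref-+ n k (tailω w))

pref-∷ʳ : ∀ n w → pref w (suc n) ≡ pref w n ∷ʳ w n
pref-∷ʳ zero    w = refl
pref-∷ʳ (suc n) w = cong (w 0 ∷_) (pref-∷ʳ n (tailω w))

length-pref : ∀ w n → length (pref w n) ≡ n
length-pref w zero    = refl
length-pref w (suc n) = cong suc (length-pref (tailω w) n)

pref-++ω : ∀ u x k → pref (u ++ω x) (length u + k) ≡ u ++ pref x k
pref-++ω []      x k = refl
pref-++ω (a ∷ u) x k = cong (a ∷_) (pref-++ω u x k)

pref-++ω-prefix : ∀ u x n → n ≤ length u → Σ Word λ r → u ≡ pref (u ++ω x) n ++ r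
pref-++ω-prefix u       x zero    _       = u , refl
pref-++ω-prefix (a ∷ u) x (suc n) (s≤s h) with r , e ← pref-++ω-prefix u x n h = r , cong (a ∷_) e

FBω-dropω : ∀ n w → FBω w → FBω (dropω n w)
FBω-dropω n w fb k = FB-factor (pref w n , [] , trans (pref-+ n k w) (cong (pref w n ++_) (sym (++-identityʳ _)))) (fb (n + k))

FBω-resp : ∀ {x y} → x ≈ω y → FBω x → FBω y
FBω-resp e fb n = subst FB (pref-cong n e) (fb n)

nth-++ˡ : ∀ u v {i} → i < length u → nth (u ++ v) i ≡ nth u i
nth-++ˡ (a ∷ u) v {zero}  _       = refl
nth-++ˡ (a ∷ u) v {suc i} (s≤s h) = nth-++ˡ u v h

length-φ : ∀ u → length u ≤ length (φ u)
length-φ []          = z≤n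
length-φ (false ∷ u) = s≤s (≤-trans (length-φ u) (n≤1+n _))
length-φ (true ∷ u)  = s≤s (length-φ u)

length-φ-pref : ∀ w n → n ≤ length (φ (pref w n))
length-φ-pref w n = subst (_≤ length (φ (pref w n))) (length-pref w n) (length-φ (pref w n))

nth-φ-pref-suc : ∀ w n {i} → i < n → nth (φ (pref w (suc n))) i ≡ nth (φ (pref w n)) i
nth-φ-pref-suc w n {i} i<n =
  trans (cong (λ v → nth v i) (trans (cong φ (pref-∷ʳ n w)) (φ-++ (pref w n) [ w n ])))
        (nth-++ˡ (φ (pref w n)) _ (≤-trans i<n (length-φ-pref w n)))

φω-unfold : ∀ w → φω w ≈ω (φ₁ (w 0) ++ω φω (tailω w))
φω-unfold w i = unfold (w 0) i
  where
  unfold : ∀ b i → nth (φ₁ b ++ φ (pref (tailω w) i)) i ≡ (φ₁ b ++ω φω (tailω w)) i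
  unfold false zero          = refl
  unfold true  zero          = refl
  unfold false (suc zero)    = refl
  unfold false (suc (suc i)) = nth-φ-pref-suc (tailω w) (suc i) ≤-refl
  unfold true  (suc i)       = refl

φω-head : ∀ w → φω w 0 ≡ false
φω-head w = trans (φω-unfold w 0) (head (w 0))
  where
  head : ∀ b → (φ₁ b ++ω φω (tailω w)) 0 ≡ false
  head false = refl
  head true  = refl

φω-second : ∀ w → φω w 1 ≡ not (w 0)
φω-second w = second (w 0) (w 1)
  where
  second : ∀ a b → nth (φ₁ a ++ φ₁ b ++ []) 1 ≡ not a
  second false _     = refl
  second true  false = refl
  second true  true  = refl

φω-dropω : ∀ n w → φω w ≈ω (φ (pref w n) ++ω φω (dropω n w))
φω-dropω zero    w i = refl
φω-dropω (suc n) w i =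
  trans (φω-unfold w i)
    (trans (++ω-cong (φ₁ (w 0)) (φω-dropω n (tailω w)) i)
      (sym (++ω-assoc (φ₁ (w 0)) (φ (pref (tailω w) n)) (φω (dropω n (tailω w))) i)))

φω-cong : ∀ {x y} → x ≈ω y → φω x ≈ω φω y
φω-cong e i = cong (λ p → nth (φ p) i) (pref-cong (suc i) e)

<lex-resp : ∀ {x x′ y y′} → x ≈ω x′ → y ≈ω y′ → x <lex y → x′ <lex y′
<lex-resp ex ey (k , agree , xk , yk) =
  k , (λ i i<k → trans (sym (ex i)) (trans (agree i i<k) (ey i))) , trans (sym (ex k)) xk , trans (sym (ey k)) yk

<lex-++ω : ∀ u {x y} → x <lex y → (u ++ω x) <lex (u ++ω y)
<lex-++ω []      l = l
<lex-++ω (a ∷ u) l with k , agree , xk , yk ← <lex-++ω u l = suc k , agree′ , xk , yk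
  where
  agree′ : ∀ i → i < suc k → ((a ∷ u) ++ω _) i ≡ ((a ∷ u) ++ω _) i
  agree′ zero    _       = refl
  agree′ (suc i) (s≤s h) = agree i h

≤lex-respˡ : ∀ {x x′ y} → x ≈ω x′ → x ≤lex y → x′ ≤lex y
≤lex-respˡ e (inj₁ x≈y) = inj₁ (λ i → trans (sym (e i)) (x≈y i))
≤lex-respˡ e (inj₂ x<y) = inj₂ (<lex-resp e (λ _ → refl) x<y)

≤lex-antisym : ∀ {x y} → x ≤lex y → y ≤lex x → x ≈ω y
≤lex-antisym (inj₁ x≈y) _          = x≈y
≤lex-antisym (inj₂ _)   (inj₁ y≈x) = ≈ω-sym y≈x
≤lex-antisym (inj₂ (k , agree , xk , yk)) (inj₂ (k′ , agree′ , yk′ , xk′)) with <-cmp k k′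
... | tri< k<k′ _ _ with () ← trans (sym yk) (trans (agree′ k k<k′) xk)
... | tri≈ _ refl _ with () ← trans (sym xk′) xk
... | tri> _ _ k′<k with () ← trans (sym xk′) (trans (agree k′ k′<k) yk′)

∷ω-mono-≤lex : ∀ a {x y} → x ≤lex y → (a ∷ω x) ≤lex (a ∷ω y)
∷ω-mono-≤lex a (inj₁ x≈y) = inj₁ λ { zero → refl ; (suc i) → x≈y i }
∷ω-mono-≤lex a (inj₂ x<y) = inj₂ (<lex-++ω [ a ] x<y)

-- φ reverses the order: the first difference 0/1 at a cut becomes 01/00 one letter later.
φω-reverses-<lex : ∀ {w₁ w₂} → w₁ <lex w₂ → φω w₂ <lex φω w₁
φω-reverses-<lex {w₁} {w₂} (k , agree , w₁k , w₂k) =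
  <lex-resp (≈ω-sym (φω-dropω k w₂)) (λ i → sym (trans (φω-dropω k w₁ i) (cong (λ p → (φ p ++ω _) i) common)))
    (<lex-++ω (φ (pref w₂ k)) first-difference)
  where
  common : pref w₁ k ≡ pref w₂ k
  common = pref-agree k w₁ w₂ agree
  first-difference : φω (dropω k w₂) <lex φω (dropω k w₁)
  first-difference =
    1 , (λ { zero _ → trans (φω-head (dropω k w₂)) (sym (φω-head (dropω k w₁))) ; (suc _) (s≤s ()) }) ,
    trans (φω-second (dropω k w₂)) (cong not (trans (dropω-head k w₂) w₂k)) ,
    trans (φω-second (dropω k w₁)) (cong not (trans (dropω-head k w₁) w₁k))

φω-antitone : ∀ {w₁ w₂} → w₁ ≤lex w₂ → φω w₂ ≤lex φω w₁
φω-antitone (inj₁ w₁≈w₂) = inj₁ (φω-cong (≈ω-sym w₁≈w₂))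
φω-antitone (inj₂ w₁<w₂) = inj₂ (φω-reverses-<lex w₁<w₂)

Parsable : ωWord → Set
Parsable x = x 0 ≡ false × (∀ i → x i ≡ true → x (suc i) ≡ false)

-- The first block of x is 01 or 0 according to its second letter.
desubst : ωWord → ωWord
desubst x zero    = not (x 1)
desubst x (suc i) = desubst (dropω (length (φ₁ (not (x 1)))) x) i

mutual
  φω-desubst : ∀ x → Parsable x → φω (desubst x) ≈ω x
  φω-desubst x (x₀ , _) zero    = trans (φω-head (desubst x)) (sym x₀)
  φω-desubst x p        (suc j) = trans (φω-unfold (desubst x) (suc j)) (after-first-block x p (x 1) refl j)

  after-first-block : ∀ x → Parsable x → ∀ b → x 1 ≡ b → ∀ j →
    (φ₁ (not b) ++ω φω (desubst (dropω (length (φ₁ (not b))) x))) (suc j) ≡ x (suc j)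
  after-first-block x p true x₁ zero    = sym x₁
  after-first-block x (_ , no11) true x₁ (suc j) =
    φω-desubst (dropω 2 x) (no11 1 x₁ , λ i → no11 (suc (suc i))) j
  after-first-block x (_ , no11) false x₁ j =
    φω-desubst (dropω 1 x) (x₁ , λ i → no11 (suc i)) j

FBω-no11 : ∀ {m} → FBω m → ∀ i → m i ≡ true → m (suc i) ≡ false
FBω-no11 {m} fb i mᵢ with m (suc i) in mᵢ₊₁
... | false = refl
... | true  = ⊥-elim (proj₁ (fb (suc (suc i))) (pref m i , [] , eleven))
  where
  eleven : pref m (suc (suc i)) ≡ pref m i ++ true ∷ true ∷ []
  eleven = begin
    pref m (suc (suc i))            ≡⟨ pref-∷ʳ (suc i) m ⟩
    pref m (suc i) ∷ʳ m (suc i)     ≡⟨ cong (_∷ʳ m (suc i)) (pref-∷ʳ i m) ⟩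
    pref m i ∷ʳ m i ∷ʳ m (suc i)    ≡⟨ cong₂ (λ a b → pref m i ∷ʳ a ∷ʳ b) mᵢ mᵢ₊₁ ⟩
    pref m i ∷ʳ true ∷ʳ true        ≡⟨ ++-assoc (pref m i) [ true ] [ true ] ⟩
    pref m i ++ true ∷ true ∷ []    ∎
    where open ≡-Reasoning

FBω-1∷-desubst : ∀ {m} → FBω m → m 0 ≡ true → m ≈ω (true ∷ω φω (desubst (tailω m)))
FBω-1∷-desubst     fb m₀ zero    = m₀
FBω-1∷-desubst {m} fb m₀ (suc i) =
  sym (φω-desubst (tailω m) (FBω-no11 fb 0 m₀ , λ i → FBω-no11 fb (suc i)) i)

FBω-φω⁻¹ : ∀ w → FBω (φω w) → FBω w
FBω-φω⁻¹ w fb n = FB-φ∷ʳ0⁻¹ (pref w n) (subst FB image (fb (length (φ (pref w n)) + 1)))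
  where
  P = pref w n
  image : pref (φω w) (length (φ P) + 1) ≡ φ P ∷ʳ false
  image = begin
    pref (φω w) (length (φ P) + 1)                         ≡⟨ pref-cong _ (φω-dropω n w) ⟩
    pref (φ P ++ω φω (dropω n w)) (length (φ P) + 1)     ≡⟨ pref-++ω (φ P) _ 1 ⟩
    φ P ∷ʳ φω (dropω n w) 0                                ≡⟨ cong (φ P ∷ʳ_) (φω-head (dropω n w)) ⟩
    φ P ∷ʳ false                                            ∎
    where open ≡-Reasoning

data Alternating : Word → Set where
  empty  : Alternating []
  single : ∀ x → Alternating (x ∷ [])
  flip   : ∀ x {r} → Alternating (not x ∷ r) → Alternating (x ∷ not x ∷ r)

00-or-11-or-alternating : ∀ w → Factor (false ∷ false ∷ []) w ⊎ Contains11 w ⊎ Alternating w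
00-or-11-or-alternating []                  = inj₂ (inj₂ empty)
00-or-11-or-alternating (x ∷ [])            = inj₂ (inj₂ (single x))
00-or-11-or-alternating (false ∷ false ∷ r) = inj₁ ([] , r , refl)
00-or-11-or-alternating (true ∷ true ∷ r)   = inj₂ (inj₁ ([] , r , refl))
00-or-11-or-alternating (false ∷ true ∷ r)  =
  Sum.map (Factor-∷ false) (Sum.map (Factor-∷ false) (flip false)) (00-or-11-or-alternating (true ∷ r))
00-or-11-or-alternating (true ∷ false ∷ r)  =
  Sum.map (Factor-∷ true) (Sum.map (Factor-∷ true) (flip true)) (00-or-11-or-alternating (false ∷ r))

alternating-7-Is4⁻Power : ∀ {a b c d e f g} → Alternating (a ∷ b ∷ c ∷ d ∷ e ∷ f ∷ g ∷ []) →
                          Is4⁻Power (a ∷ b ∷ c ∷ d ∷ e ∷ f ∷ g ∷ [])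
alternating-7-Is4⁻Power (flip false (flip _ (flip _ (flip _ (flip _ (flip _ (single _))))))) = false , true ∷ [] , refl
alternating-7-Is4⁻Power (flip true  (flip _ (flip _ (flip _ (flip _ (flip _ (single _))))))) = true , false ∷ [] , refl

pref-two-letters : ∀ p {a b s} n x → pref x n ≡ p ++ a ∷ b ∷ s →
                   dropω (length p) x 0 ≡ a × dropω (length p) x 1 ≡ b
pref-two-letters []      (suc (suc n)) x e = ∷-injectiveˡ e , ∷-injectiveˡ (∷-injectiveʳ e)
pref-two-letters (_ ∷ p) (suc n)       x e = pref-two-letters p n (tailω x) (∷-injectiveʳ e)

≤lex-00 : ∀ {x y} → x ≤lex y → y 0 ≡ false → y 1 ≡ false → x 0 ≡ false × x 1 ≡ false
≤lex-00 (inj₁ x≈y) y₀ y₁ = trans (x≈y 0) y₀ , trans (x≈y 1) y₁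
≤lex-00 (inj₂ (zero , _ , _ , yk)) y₀ y₁ with () ← trans (sym yk) y₀
≤lex-00 (inj₂ (suc zero , _ , _ , yk)) y₀ y₁ with () ← trans (sym yk) y₁
≤lex-00 (inj₂ (suc (suc k) , agree , _ , _)) y₀ y₁ =
  trans (agree 0 (s≤s z≤n)) y₀ , trans (agree 1 (s≤s (s≤s z≤n))) y₁

≤lex-head-true : ∀ {x y} → x ≤lex y → x 0 ≡ true → y 0 ≡ true
≤lex-head-true (inj₁ x≈y)                   x₀ = trans (sym (x≈y 0)) x₀
≤lex-head-true (inj₂ (zero , _ , xk , _))    x₀ with () ← trans (sym x₀) xk
≤lex-head-true (inj₂ (suc k , agree , _ , _)) x₀ = trans (sym (agree 0 (s≤s z≤n))) x₀

IsLeastFB-00 : ∀ {ℓ} → IsLeastFB ℓ → ℓ 0 ≡ false × ℓ 1 ≡ false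
IsLeastFB-00 {ℓ} (fb , least) with 00-or-11-or-alternating (pref ℓ 7)
... | inj₂ (inj₁ c) = ⊥-elim (proj₁ (fb 7) c)
... | inj₂ (inj₂ a) = ⊥-elim (proj₂ (fb 7) _ ([] , [] , sym (++-identityʳ _)) (alternating-7-Is4⁻Power a))
... | inj₁ (p , s , e) with d₀ , d₁ ← pref-two-letters p 7 ℓ e =
  ≤lex-00 (least _ (FBω-dropω (length p) ℓ fb)) d₀ d₁

FBω-1φω00 : ∀ {ℓ} → FBω ℓ → ℓ 0 ≡ false × ℓ 1 ≡ false → FBω (true ∷ω φω ℓ)
FBω-1φω00 {ℓ} fb (ℓ₀ , ℓ₁) n = FB-factor prefix 1φP-FB
  where
  N = 2 + n
  P = pref ℓ N
  prefix : Factor (pref (true ∷ω φω ℓ) n) (true ∷ φ P)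
  prefix with r , e ← pref-++ω-prefix (true ∷ φ P) (φω (dropω N ℓ)) n
                        (≤-trans (m≤n+m n 2) (≤-trans (length-φ-pref ℓ N) (n≤1+n _))) =
    [] , r , trans e (cong (_++ r) (sym (pref-cong n (++ω-cong [ true ] (φω-dropω N ℓ)))))
  u₀ = pref (dropω 2 ℓ) n
  P≡00u₀ : P ≡ false ∷ false ∷ u₀
  P≡00u₀ = cong₂ (λ a b → a ∷ b ∷ u₀) ℓ₀ ℓ₁
  1φP-FB : FB (true ∷ φ P)
  1φP-FB = subst (λ v → FB (true ∷ φ v)) (sym P≡00u₀) (FB-1φ00 u₀ (subst FB P≡00u₀ (fb N)))

lemma13 : (ℓ m : ωWord) → IsLeastFB ℓ → IsGreatestFB m →
    m ≈ω (true ∷ω φω ℓ)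
lemma13 ℓ m isLeast@(fbℓ , least) (fbm , greatest) = ≈ω-sym (≤lex-antisym x≤m m≤x)
  where
  x = true ∷ω φω ℓ
  x≤m : x ≤lex m
  x≤m = greatest x (FBω-1φω00 fbℓ (IsLeastFB-00 isLeast))
  w = desubst (tailω m)
  m≈1φw : m ≈ω (true ∷ω φω w)
  m≈1φw = FBω-1∷-desubst fbm (≤lex-head-true x≤m refl)
  w-FB : FBω w
  w-FB = FBω-φω⁻¹ w (FBω-resp (m≈1φw ∘ suc) (FBω-dropω 1 m fbm))
  m≤x : m ≤lex x
  m≤x = ≤lex-respˡ (≈ω-sym m≈1φw) (∷ω-mono-≤lex true (φω-antitone (least w w-FB)))
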